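{- Let \(\mathcal V\) be a universe. The following are equivalent: (i) there is a positive locally small \(\delta_{\mathcal V}\)-complete poset with \(\lnot\lnot\)-stable equality; (ii) there is a positive locally small \(\delta_{\mathcal V}\)-complete poset with decidable equality; (iii) excluded middle in \(\mathcal V\) holds.
   Context: Work in univalent foundations (intensional Martin-Löf type theory with universes, function and propositional extensionality, propositional truncations). "There is" means one can construct such a structure, with carrier in any universe. A poset is a type \(X\) with a proposition-valued reflexive, transitive, antisymmetric relation \(\sqsubseteq\). It is \(\delta_{\mathcal V}\)-complete if for all \(x\sqsubseteq y\) and every proposition \(P:\mathcal V\), the family \(\delta_{x,y,P}:\mathbf 1+P\to X\), \(\mathrm{inl}(\star)\mapsto x\), \(\mathrm{inr}(p)\mapsto y\), has a supremum \(\bigvee\delta_{x,y,P}\). In such a poset, \(x\) is strictly below \(y\) if \(x\sqsubseteq y\) and for every \(z\sqsupseteq y\) and every proposition \(P:\mathcal V\), \(z=\bigvee\delta_{x,z,P}\) implies \(P\). The poset is positive if it comes with designated \(x,y\) with \(x\) strictly below \(y\). It is locally small if there is a \(\mathcal V\)-valued relation \(\sqsubseteq_{\mathcal V}\) with \((x\sqsubseteq y)\simeq(x\sqsubseteq_{\mathcal V}y)\). Equality is \(\lnot\lnot\)-stable if \(\lnot\lnot(x=y)\to x=y\) for all \(x,y\), and decidable if \((x=y)+\lnot(x=y)\) for all \(x,y\). Excluded middle in \(\mathcal V\): every proposition \(P:\mathcal V\) satisfies \(P\) or \(\lnot P\). -}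

module Defs where

open import Level using (Level; _⊔_) renaming (suc to lsuc)
open import Data.Unit using (⊤; tt)
open import Data.Sum using (_⊎_; inj₁; inj₂)
open import Data.Product using (Σ; _×_; _,_; proj₁)
open import Relation.Nullary using (¬_)
open import Relation.Binary.PropositionalEquality using (_≡_)
open import Function.Bundles using (_↔_)

isProp : ∀ {a} → Set a → Set a
isProp A = (x y : A) → x ≡ y

record Poset (𝓤 𝓣 : Level) : Set (lsuc (𝓤 ⊔ 𝓣)) where
  field
    Carrier   : Set 𝓤
    _⊑_       : Carrier → Carrier → Set 𝓣
    ⊑-prop    : ∀ x y → isProp (x ⊑ y)
    ⊑-refl    : ∀ x → x ⊑ x
    ⊑-trans   : ∀ x y z → x ⊑ y → y ⊑ z → x ⊑ z
    ⊑-antisym : ∀ x y → x ⊑ y → y ⊑ x → x ≡ y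

module _ {𝓤 𝓣 : Level} (X : Poset 𝓤 𝓣) where
  open Poset X

  IsSup : ∀ {𝓦} {I : Set 𝓦} → (I → Carrier) → Carrier → Set (𝓦 ⊔ 𝓤 ⊔ 𝓣)
  IsSup {I = I} α s = (∀ i → α i ⊑ s) × (∀ u → (∀ i → α i ⊑ u) → s ⊑ u)

  HasSup : ∀ {𝓦} {I : Set 𝓦} → (I → Carrier) → Set (𝓦 ⊔ 𝓤 ⊔ 𝓣)
  HasSup α = Σ Carrier (IsSup α)

  δ : ∀ {𝓥} → Carrier → Carrier → (P : Set 𝓥) → ⊤ ⊎ P → Carrier
  δ x y P (inj₁ _) = x
  δ x y P (inj₂ _) = y

  δ-complete : (𝓥 : Level) → Set (lsuc 𝓥 ⊔ 𝓤 ⊔ 𝓣)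
  δ-complete 𝓥 = ∀ x y → x ⊑ y → (P : Set 𝓥) → isProp P → HasSup (δ x y P)

  module _ {𝓥 : Level} (c : δ-complete 𝓥) where
    ⋁δ : ∀ x y → x ⊑ y → (P : Set 𝓥) → isProp P → Carrier
    ⋁δ x y l P i = proj₁ (c x y l P i)

    StrictlyBelow : Carrier → Carrier → Set (lsuc 𝓥 ⊔ 𝓤 ⊔ 𝓣)
    StrictlyBelow x y =
      Σ (x ⊑ y) λ l → ∀ z → (m : y ⊑ z) → (P : Set 𝓥) → (i : isProp P)
        → z ≡ ⋁δ x z (⊑-trans x y z l m) P i → P

    Positive : Set (lsuc 𝓥 ⊔ 𝓤 ⊔ 𝓣)
    Positive = Σ Carrier λ x → Σ Carrier λ y → StrictlyBelow x y

  LocallySmall : (𝓥 : Level) → Set (lsuc 𝓥 ⊔ 𝓤 ⊔ 𝓣)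
  LocallySmall 𝓥 = Σ (Carrier → Carrier → Set 𝓥) λ _⊑ᵥ_ → ∀ x y → (x ⊑ y) ↔ (x ⊑ᵥ y)

  ¬¬-StableEquality : Set 𝓤
  ¬¬-StableEquality = ∀ (x y : Carrier) → ¬ ¬ (x ≡ y) → x ≡ y

  DecidableEquality : Set 𝓤
  DecidableEquality = ∀ (x y : Carrier) → (x ≡ y) ⊎ ¬ (x ≡ y)

ConditionI : (𝓥 𝓤 𝓣 : Level) → Set (lsuc (𝓥 ⊔ 𝓤 ⊔ 𝓣))
ConditionI 𝓥 𝓤 𝓣 = Σ (Poset 𝓤 𝓣) λ X → Σ (δ-complete X 𝓥) λ c →
  Positive X c × LocallySmall X 𝓥 × ¬¬-StableEquality X

ConditionII : (𝓥 𝓤 𝓣 : Level) → Set (lsuc (𝓥 ⊔ 𝓤 ⊔ 𝓣))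
ConditionII 𝓥 𝓤 𝓣 = Σ (Poset 𝓤 𝓣) λ X → Σ (δ-complete X 𝓥) λ c →
  Positive X c × LocallySmall X 𝓥 × DecidableEquality X

EM : (𝓥 : Level) → Set (lsuc 𝓥)
EM 𝓥 = (P : Set 𝓥) → isProp P → P ⊎ ¬ P

{-# OPTIONS --safe #-}
-- For x strictly below y, a proposition P holds exactly when ⋁ δ_{x,y,P} = y.
-- So ¬¬-stable (a fortiori decidable) equality makes every proposition of 𝓥
-- ¬¬-stable, and ¬¬-stability of the proposition P + ¬P is excluded middle.
-- Conversely, under excluded middle every poset is δ_𝓥-complete, and the
-- booleans with false ⊑ true witness (ii).
module Submission where

open import Defs
open import Level using (Level; 0ℓ; Lift; lift; lower)
open import Data.Product using (_×_; _,_; proj₂)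
open import Data.Sum using (_⊎_; inj₁; inj₂)
import Data.Sum as Sum
open import Data.Unit using (tt)
open import Data.Bool using (Bool; true; false; _≤_; f≤t; _≟_)
open import Data.Bool.Properties using (≤-refl; ≤-trans; ≤-antisym; ≤-irrelevant)
open import Relation.Nullary using (¬_)
open import Relation.Nullary.Negation using (¬¬-map; contradiction)
open import Relation.Nullary.Decidable using (decidable-stable; fromSum; toSum; ¬¬-excluded-middle)
open import Relation.Binary.PropositionalEquality using (_≡_; refl; sym; trans; cong; subst)
open import Function.Base using (_∘_; id)
open import Function.Bundles using (_⇔_; mk⇔; mk↔ₛ′)
open import Axiom.Extensionality.Propositional using (Extensionality)

⊎¬-isProp : ∀ {𝓥} {P : Set 𝓥} → Extensionality 𝓥 0ℓ → isProp P → isProp (P ⊎ ¬ P)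
⊎¬-isProp funext i (inj₁ p) (inj₁ q) = cong inj₁ (i p q)
⊎¬-isProp funext i (inj₁ p) (inj₂ ¬q) = contradiction p ¬q
⊎¬-isProp funext i (inj₂ ¬p) (inj₁ q) = contradiction q ¬p
⊎¬-isProp funext i (inj₂ ¬p) (inj₂ ¬q) = cong inj₂ (funext λ p → contradiction p ¬p)

¬¬-stable-props⇒EM : ∀ {𝓥} → Extensionality 𝓥 0ℓ
  → ((P : Set 𝓥) → isProp P → ¬ ¬ P → P) → EM 𝓥
¬¬-stable-props⇒EM funext stable P i =
  stable (P ⊎ ¬ P) (⊎¬-isProp funext i) (¬¬-map toSum ¬¬-excluded-middle)

module _ {𝓤 𝓣} (X : Poset 𝓤 𝓣) where
  open Poset X

  IsSup-unique : ∀ {𝓦} {I : Set 𝓦} {α : I → Carrier} {s t}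
    → IsSup X α s → IsSup X α t → s ≡ t
  IsSup-unique (s-ub , s-least) (t-ub , t-least) =
    ⊑-antisym _ _ (s-least _ t-ub) (t-least _ s-ub)

  δ-IsSup-top : ∀ {𝓥} {x y} {P : Set 𝓥} → x ⊑ y → P → IsSup X (δ X x y P) y
  δ-IsSup-top {y = y} x⊑y p =
    (λ { (inj₁ _) → x⊑y ; (inj₂ _) → ⊑-refl y }) , λ u ub → ub (inj₂ p)

  δ-IsSup-bottom : ∀ {𝓥} {x y} {P : Set 𝓥} → ¬ P → IsSup X (δ X x y P) x
  δ-IsSup-bottom {x = x} ¬p =
    (λ { (inj₁ _) → ⊑-refl x ; (inj₂ p) → contradiction p ¬p }) , λ u ub → ub (inj₁ tt)

  EM⇒δ-complete : ∀ {𝓥} → EM 𝓥 → δ-complete X 𝓥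
  EM⇒δ-complete em x y x⊑y P i with em P i
  ... | inj₁ p  = y , δ-IsSup-top x⊑y p
  ... | inj₂ ¬p = x , δ-IsSup-bottom ¬p

  module _ {𝓥} (c : δ-complete X 𝓥) {x y : Carrier} (x⊑y : x ⊑ y)
           {P : Set 𝓥} (i : isProp P) where

    ⋁δ-≡-top : P → ⋁δ X c x y x⊑y P i ≡ y
    ⋁δ-≡-top p = IsSup-unique (proj₂ (c x y x⊑y P i)) (δ-IsSup-top x⊑y p)

    ⋁δ-≡-bottom : ¬ P → ⋁δ X c x y x⊑y P i ≡ x
    ⋁δ-≡-bottom ¬p = IsSup-unique (proj₂ (c x y x⊑y P i)) (δ-IsSup-bottom ¬p)

    ⋁δ-≡-top⇒holds : StrictlyBelow X c x y → ⋁δ X c x y x⊑y P i ≡ y → P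
    ⋁δ-≡-top⇒holds (_ , strict) ⋁δ≡y =
      strict y (⊑-refl y) P i
        (subst (λ l → y ≡ ⋁δ X c x y l P i) (⊑-prop x y x⊑y _) (sym ⋁δ≡y))

  EM⇒StrictlyBelow : ∀ {𝓥} (em : EM 𝓥) {x y} → x ⊑ y → (∀ z → y ⊑ z → ¬ x ≡ z)
    → StrictlyBelow X (EM⇒δ-complete em) x y
  EM⇒StrictlyBelow em {x} {y} x⊑y x≢above = x⊑y , holds
    where
    holds : ∀ z (y⊑z : y ⊑ z) (P : Set _) (i : isProp P)
      → z ≡ ⋁δ X (EM⇒δ-complete em) x z (⊑-trans x y z x⊑y y⊑z) P i → P
    holds z y⊑z P i z≡⋁δ = Sum.[ id , refuted ] (em P i)
      where
      refuted : ¬ P → P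
      refuted ¬p = contradiction
        (trans z≡⋁δ (⋁δ-≡-bottom (EM⇒δ-complete em) (⊑-trans x y z x⊑y y⊑z) i ¬p))
        (x≢above z y⊑z ∘ sym)

  Positive⇒¬¬-stable-props : ∀ {𝓥} (c : δ-complete X 𝓥) → Positive X c
    → ¬¬-StableEquality X → (P : Set 𝓥) → isProp P → ¬ ¬ P → P
  Positive⇒¬¬-stable-props c (x , y , sb@(x⊑y , _)) stable P i ¬¬p =
    ⋁δ-≡-top⇒holds c x⊑y i sb
      (stable _ _ (¬¬-map (⋁δ-≡-top c x⊑y i) ¬¬p))

  Decidable⇒¬¬-StableEquality : DecidableEquality X → ¬¬-StableEquality X
  Decidable⇒¬¬-StableEquality dec x y = decidable-stable (fromSum (dec x y))

Bool-poset : (𝓤 𝓣 : Level) → Poset 𝓤 𝓣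
Bool-poset 𝓤 𝓣 = record
  { Carrier   = Lift 𝓤 Bool
  ; _⊑_       = λ a b → Lift 𝓣 (lower a ≤ lower b)
  ; ⊑-prop    = λ _ _ p q → cong lift (≤-irrelevant (lower p) (lower q))
  ; ⊑-refl    = λ _ → lift ≤-refl
  ; ⊑-trans   = λ _ _ _ p q → lift (≤-trans (lower p) (lower q))
  ; ⊑-antisym = λ _ _ p q → cong lift (≤-antisym (lower p) (lower q))
  }

Bool-LocallySmall : ∀ {𝓥 𝓤 𝓣} → LocallySmall (Bool-poset 𝓤 𝓣) 𝓥
Bool-LocallySmall {𝓥} =
    (λ a b → Lift 𝓥 (lower a ≤ lower b))
  , λ _ _ → mk↔ₛ′ (lift ∘ lower) (lift ∘ lower) (λ _ → refl) (λ _ → refl)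

Bool-DecidableEquality : ∀ {𝓤 𝓣} → DecidableEquality (Bool-poset 𝓤 𝓣)
Bool-DecidableEquality (lift a) (lift b) =
  Sum.map (cong lift) (λ a≢b → a≢b ∘ cong lower) (toSum (a ≟ b))

module _ {𝓥 𝓤 𝓣 : Level} where

  EM⇒ConditionII : EM 𝓥 → ConditionII 𝓥 𝓤 𝓣
  EM⇒ConditionII em =
      Bool-poset 𝓤 𝓣 , EM⇒δ-complete _ em
    , (lift false , lift true , EM⇒StrictlyBelow _ em (lift f≤t) false≢above)
    , Bool-LocallySmall , Bool-DecidableEquality {𝓣 = 𝓣}
    where
    false≢above : ∀ z → Lift 𝓣 (true ≤ lower z) → ¬ lift false ≡ z
    false≢above (lift true) _ ()

  ConditionII⇒ConditionI : ConditionII 𝓥 𝓤 𝓣 → ConditionI 𝓥 𝓤 𝓣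
  ConditionII⇒ConditionI (X , c , pos , ls , dec) =
    X , c , pos , ls , Decidable⇒¬¬-StableEquality X dec

  ConditionI⇒EM : Extensionality 𝓥 0ℓ → ConditionI 𝓥 𝓤 𝓣 → EM 𝓥
  ConditionI⇒EM funext (X , c , pos , _ , stable) =
    ¬¬-stable-props⇒EM funext (Positive⇒¬¬-stable-props X c pos stable)

theorem4p27 : (funext : ∀ {a b} → Extensionality a b) → (𝓥 𝓤 𝓣 : Level)
    → (ConditionI 𝓥 𝓤 𝓣 ⇔ EM 𝓥) × (ConditionII 𝓥 𝓤 𝓣 ⇔ EM 𝓥)
theorem4p27 funext 𝓥 𝓤 𝓣 =
    mk⇔ (ConditionI⇒EM funext) (ConditionII⇒ConditionI ∘ EM⇒ConditionII)
  , mk⇔ (ConditionI⇒EM funext ∘ ConditionII⇒ConditionI) EM⇒ConditionII
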